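{- If $G$ is an infinite graph with finite metric dimension, then $G$ does not contain an infinite family of metric rays whose vertex sets are pairwise disjoint.
   Context: All graphs are simple, connected and locally finite (every vertex has finite degree); they may have infinitely many vertices. $d_G(u,v)$ denotes the shortest-path distance. A vertex $x$ resolves two vertices $u,v$ if $d(u,x)\neq d(v,x)$. A set $S\subseteq V(G)$ is a resolving set if every pair of distinct vertices is resolved by some vertex of $S$. The metric dimension $\beta(G)$ is the minimum cardinality of a resolving set if a finite resolving set exists, and $\beta(G)=\infty$ otherwise. A metric ray with endpoint $u_0$ in $G$ is a subgraph $P$ of $G$ isomorphic to the one-way infinite path, with an ordering $V(P)=\{u_0,u_1,u_2,\dots\}$ such that $u_k$ is adjacent to $u_{k+1}$ in $P$ for all $k\ge 0$ and $d_G(u_0,u_k)=d_P(u_0,u_k)=k$ for all $k$. -}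

module Defs where

open import Data.Nat using (ℕ; zero; suc; _≤_)
open import Data.Product using (Σ; ∃; _×_; _,_)
open import Data.List using (List)
open import Data.List.Membership.Propositional using (_∈_)
open import Data.List.Relation.Unary.Any using (Any)
open import Relation.Binary.PropositionalEquality using (_≡_; _≢_)
open import Relation.Nullary using (¬_)
open import Function.Bundles using (_⇔_)

record Graph : Set₁ where
  field
    V   : Set
    E   : V → V → Set

module _ (G : Graph) where
  open Graph G

  data Walk : V → V → ℕ → Set where
    here : ∀ {u} → Walk u u zero
    step : ∀ {u w v n} → E u w → Walk w v n → Walk u v (suc n)

  Simple : Set
  Simple = (∀ u v → E u v → E v u) × (∀ u → ¬ E u u)

  Connected : Set
  Connected = ∀ u v → ∃ λ n → Walk u v n

  LocallyFinite : Set
  LocallyFinite = ∀ u → Σ (List V) λ ns → ∀ v → (E u v ⇔ (v ∈ ns))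

  FiniteVertices : Set
  FiniteVertices = Σ (List V) λ vs → ∀ v → v ∈ vs

  InfiniteGraph : Set
  InfiniteGraph = ¬ FiniteVertices

  Dist : V → V → ℕ → Set
  Dist u v n = Walk u v n × (∀ m → Walk u v m → n ≤ m)

  Resolves : V → V → V → Set
  Resolves x u v = ∀ m n → Dist u x m → Dist v x n → m ≢ n

  IsResolvingSet : List V → Set
  IsResolvingSet S = ∀ u v → u ≢ v → Any (λ x → Resolves x u v) S

  FiniteMetricDimension : Set
  FiniteMetricDimension = Σ (List V) IsResolvingSet

  IsMetricRay : (ℕ → V) → Set
  IsMetricRay r = (∀ k → E (r k) (r (suc k))) × (∀ k → Dist (r zero) (r k) k)

  DisjointRayFamily : (ℕ → ℕ → V) → Set
  DisjointRayFamily R =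
    (∀ i → IsMetricRay (R i)) × (∀ i j → i ≢ j → ∀ k l → R i k ≢ R j l)

-- Let S = x₁ … xₙ be a resolving set and fix a centre c.  If every landmark
-- xⱼ is within distance D of c, then the distance profile
-- (d(u,x₁), …, d(u,xₙ)) of any vertex u on the sphere of radius M around c
-- lies in the window [M - D, M + D]ⁿ, so at most (2D+1)ⁿ profiles occur on
-- that sphere.  Take N = (2D+1)ⁿ + 1 of the rays and M at least the distance
-- from c to each of their endpoints.  Along a metric ray the distance to c
-- changes by at most one per step and eventually exceeds M, so each of the N
-- rays meets the sphere of radius M.  By pigeonhole two of these N disjoint
-- (hence distinct) sphere points share a profile, so S does not resolve them.
--
-- The development is constructive: distances exist only up to double
-- negation, which is harmless because the theorem is itself a negation.
module Submission where

open import Defs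
open import Data.Nat using (ℕ; zero; suc; _+_; _∸_; _^_; _≤_; _<_; _≤?_; s≤s)
open import Data.Nat.Properties
open import Data.Nat.Induction using (<-rec)
open import Data.Fin as Fin using (Fin; toℕ; fromℕ<; funToFin; finToFun)
open import Data.Fin.Properties using (pigeonhole; finToFun-funToFin; toℕ-fromℕ<)
open import Data.List using (List; length; lookup; tabulate)
open import Data.List.Extrema.Nat using (max; xs≤max)
open import Data.List.Relation.Unary.All.Properties using (tabulate⁻)
open import Data.List.Relation.Unary.Any using (Any; index)
open import Data.List.Relation.Unary.Any.Properties using (lookup-index)
open import Data.Product using (Σ; ∃; ∃₂; _×_; _,_; proj₁; proj₂)
open import Data.Empty using (⊥-elim)
open import Relation.Nullary using (¬_; yes; no)
open import Relation.Nullary.Negation using (DoubleNegation)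
open import Relation.Binary.PropositionalEquality using (_≡_; refl; cong; sym; module ≡-Reasoning)
open import Function using (_∘_)

¬¬-choice : ∀ {n} {P : Fin n → Set} → (∀ i → DoubleNegation (P i)) →
            DoubleNegation (∀ i → P i)
¬¬-choice {zero}  h k = k (λ ())
¬¬-choice {suc n} {P} h k =
  h Fin.zero λ p₀ → ¬¬-choice {n} {P ∘ Fin.suc} (h ∘ Fin.suc) λ ps →
    k λ { Fin.zero → p₀ ; (Fin.suc i) → ps i }

Least : (ℕ → Set) → Set
Least P = Σ ℕ λ m → P m × (∀ k → P k → m ≤ k)

-- An inhabited predicate on ℕ has (not not) a least element; this is how
-- shortest-path distances come into existence.
¬¬-least : ∀ {P : ℕ → Set} {n} → P n → DoubleNegation (Least P)
¬¬-least {P} {n} pn noLeast = <-rec (λ m → ¬ P m) absent n pn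
  where
    absent : ∀ m → (∀ {k} → k < m → ¬ P k) → ¬ P m
    absent m smaller pm = noLeast (m , pm , minimal)
      where
        minimal : ∀ k → P k → m ≤ k
        minimal k pk with m ≤? k
        ... | yes m≤k = m≤k
        ... | no  m≰k = ⊥-elim (smaller (≰⇒> m≰k) pk)

maximum : ∀ {n} → (Fin n → ℕ) → ℕ
maximum f = max 0 (tabulate f)

≤-maximum : ∀ {n} (f : Fin n → ℕ) i → f i ≤ maximum f
≤-maximum f = tabulate⁻ (xs≤max 0 (tabulate f))

-- Discrete intermediate value theorem, for a relation D k e ("the value at k
-- is e") whose values exist only up to double negation: if values grow by at
-- most one per step, start at most m and are at least m at K, then m is hit.
¬¬-intermediate-value :
  (D : ℕ → ℕ → Set) → (∀ k → DoubleNegation (Σ ℕ (D k))) →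
  (∀ {k e e′} → D k e → D (suc k) e′ → e′ ≤ suc e) →
  ∀ {m} K → (∀ {e} → D 0 e → e ≤ m) → (∀ {e} → D K e → m ≤ e) →
  DoubleNegation (∃ λ k → D k m)
¬¬-intermediate-value D value slow {m} K start end noHit =
  stays-below K λ (e , d , e<m) → <⇒≱ e<m (end d)
  where
    below : ∀ {k e} → D k e → e ≤ m → e < m
    below d e≤m = ≤∧≢⇒< e≤m λ { refl → noHit (_ , d) }

    stays-below : ∀ k → DoubleNegation (Σ ℕ λ e → D k e × e < m)
    stays-below zero    found = value 0 λ (e , d) → found (e , d , below d (start d))
    stays-below (suc k) found = stays-below k λ (e , d , e<m) →
      value (suc k) λ (e′ , d′) → found (e′ , d′ , below d′ (≤-trans (slow d d′) e<m))

pigeonhole-window :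
  ∀ {n N} L W → suc W ^ n < N → (F : Fin N → Fin n → ℕ) →
  (∀ i j → L ≤ F i j × F i j ≤ L + W) →
  ∃₂ λ i i′ → i Fin.< i′ × (∀ j → F i j ≡ F i′ j)
pigeonhole-window {n} L W many F window =
  let (i , i′ , i<i′ , same) = pigeonhole many (funToFin ∘ code)
  in  i , i′ , i<i′ , λ j → decode i i′ j (codes-agree same j)
  where
    offset< : ∀ i j → F i j ∸ L < suc W
    offset< i j = s≤s (m≤n+o⇒m∸n≤o (F i j) L (proj₂ (window i j)))

    code : Fin _ → Fin n → Fin (suc W)
    code i j = fromℕ< (offset< i j)

    codes-agree : ∀ {i i′} → funToFin (code i) ≡ funToFin (code i′) →
                  ∀ j → code i j ≡ code i′ j
    codes-agree {i} {i′} same j = begin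
      code i j                         ≡⟨ sym (finToFun-funToFin (code i) j) ⟩
      finToFun (funToFin (code i)) j   ≡⟨ cong (λ z → finToFun z j) same ⟩
      finToFun (funToFin (code i′)) j  ≡⟨ finToFun-funToFin (code i′) j ⟩
      code i′ j                        ∎
      where open ≡-Reasoning

    decode : ∀ i i′ j → code i j ≡ code i′ j → F i j ≡ F i′ j
    decode i i′ j eq = ∸-cancelʳ-≡ (proj₁ (window i j)) (proj₁ (window i′ j)) (begin
      F i j ∸ L          ≡⟨ sym (toℕ-fromℕ< (offset< i j)) ⟩
      toℕ (code i j)     ≡⟨ cong toℕ eq ⟩
      toℕ (code i′ j)    ≡⟨ toℕ-fromℕ< (offset< i′ j) ⟩
      F i′ j ∸ L         ∎)
      where open ≡-Reasoning

module Walks (G : Graph) (simple : Simple G) where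
  open Graph G

  _++_ : ∀ {u w v a b} → Walk G u w a → Walk G w v b → Walk G u v (a + b)
  here     ++ q = q
  step e p ++ q = step e (p ++ q)

  _∷ʳ_ : ∀ {u v w n} → Walk G u v n → E v w → Walk G u w (suc n)
  here     ∷ʳ e = step e here
  step f p ∷ʳ e = step f (p ∷ʳ e)

  reverse : ∀ {u v n} → Walk G u v n → Walk G v u n
  reverse here       = here
  reverse (step e p) = reverse p ∷ʳ proj₁ simple _ _ e

module Distances (G : Graph) (simple : Simple G) (conn : Connected G) where
  open Graph G
  open Walks G simple

  distance-exists : ∀ u v → DoubleNegation (Σ ℕ (Dist G u v))
  distance-exists u v = ¬¬-least (proj₂ (conn u v))

  dist-≤-via : ∀ {u w v e a b} → Dist G u v e → Walk G u w a → Walk G w v b →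
               e ≤ a + b
  dist-≤-via d p q = proj₂ d _ (p ++ q)

  -- A metric ray whose endpoint is within distance m of c meets the sphere
  -- of radius m around c: the distance to c grows by at most one per step,
  -- and at position m + w (w the length of a walk from c to the endpoint) it
  -- is at least m because the ray is geodesic.
  ray-meets-sphere : ∀ {r} → IsMetricRay G r → ∀ {c w} → Walk G c (r 0) w →
                     ∀ {m} → w ≤ m → DoubleNegation (∃ λ k → Dist G c (r k) m)
  ray-meets-sphere {r} (edges , geodesic) {c} {w} p {m} w≤m =
    ¬¬-intermediate-value (λ k → Dist G c (r k)) (λ k → distance-exists c (r k))
      slow (m + w) start end
    where
      slow : ∀ {k e e′} → Dist G c (r k) e → Dist G c (r (suc k)) e′ → e′ ≤ suc e
      slow {k} d d′ = proj₂ d′ _ (proj₁ d ∷ʳ edges k)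

      start : ∀ {e} → Dist G c (r 0) e → e ≤ m
      start d = ≤-trans (proj₂ d _ p) w≤m

      end : ∀ {e} → Dist G c (r (m + w)) e → m ≤ e
      end {e} d = +-cancelˡ-≤ w m e (begin
        w + m  ≡⟨ +-comm w m ⟩
        m + w  ≤⟨ dist-≤-via (geodesic (m + w)) (reverse p) (proj₁ d) ⟩
        w + e  ∎)
        where open ≤-Reasoning

module Landmarks (G : Graph) (simple : Simple G) (conn : Connected G)
                 (S : List (Graph.V G)) where
  open Graph G
  open Walks G simple
  open Distances G simple conn

  landmark : Fin (length S) → V
  landmark = lookup S

  Profile : V → Set
  Profile u = ∀ j → Σ ℕ (Dist G u (landmark j))

  profile-exists : ∀ u → DoubleNegation (Profile u)
  profile-exists u = ¬¬-choice λ j → distance-exists u (landmark j)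

  same-profile-unresolved : ∀ {u v} (pu : Profile u) (pv : Profile v) →
    (∀ j → proj₁ (pu j) ≡ proj₁ (pv j)) → ¬ Any (λ x → Resolves G x u v) S
  same-profile-unresolved pu pv same resolved =
    lookup-index resolved _ _ (proj₂ (pu j)) (proj₂ (pv j)) (same j)
    where j = index resolved

  record SpherePoint (c : V) (M : ℕ) (r : ℕ → V) : Set where
    field
      position  : ℕ
      on-sphere : Dist G c (r position) M
      profile   : Profile (r position)

    distance-to : Fin (length S) → ℕ
    distance-to j = proj₁ (profile j)

  open SpherePoint public

  sphere-point : ∀ {r} → IsMetricRay G r → ∀ {c w} → Walk G c (r 0) w →
                 ∀ {M} → w ≤ M → DoubleNegation (SpherePoint c M r)
  sphere-point {r} ray p w≤M found =
    ray-meets-sphere ray p w≤M λ (k , d) →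
      profile-exists (r k) λ pr → found (record { position = k ; on-sphere = d ; profile = pr })

  -- If landmark j is within D of c, then its distance e from a point on the
  -- sphere of radius M lies in [M - D, M + D]; stated for e + D to stay in ℕ.
  profile-window : ∀ {c M r} (s : SpherePoint c M r) j {a D} →
    Walk G c (landmark j) a → a ≤ D →
    M ≤ distance-to s j + D × distance-to s j + D ≤ M + (D + D)
  profile-window {c} {M} s j {a} {D} p a≤D = lower , upper
    where
      e = distance-to s j

      lower : M ≤ e + D
      lower = begin
        M      ≤⟨ dist-≤-via (on-sphere s) p (reverse (proj₁ (proj₂ (profile s j)))) ⟩
        a + e  ≤⟨ +-monoˡ-≤ e a≤D ⟩
        D + e  ≡⟨ +-comm D e ⟩
        e + D  ∎
        where open ≤-Reasoning

      upper : e + D ≤ M + (D + D)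
      upper = begin
        e + D        ≤⟨ +-monoˡ-≤ D (dist-≤-via (proj₂ (profile s j)) (reverse (proj₁ (on-sphere s))) p) ⟩
        M + a + D    ≤⟨ +-monoˡ-≤ D (+-monoʳ-≤ M a≤D) ⟩
        M + D + D    ≡⟨ +-assoc M D D ⟩
        M + (D + D)  ∎
        where open ≤-Reasoning

-- Take N = (2D+1)ⁿ + 1 rays, where D bounds the distances from c = R 0 0 to
-- the n landmarks, and M bounds the distances from c to their endpoints.
-- Each ray meets the sphere of radius M; two of these points share a profile
-- by pigeonhole, yet they are distinct because the rays are disjoint.
theorem2 : (G : Graph) → Simple G → Connected G → LocallyFinite G →
    InfiniteGraph G → FiniteMetricDimension G →
    ¬ Σ (ℕ → ℕ → Graph.V G) (DisjointRayFamily G)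
theorem2 G simple conn _ _ (S , resolving) (R , rays , disjoint) =
  ¬¬-choice (λ i → sphere-point (rays (toℕ i)) (proj₂ (toRay i)) (≤-maximum (proj₁ ∘ toRay) i))
  λ points →
    let F : Fin N → Fin (length S) → ℕ
        F i j = distance-to (points i) j + D
        (i , i′ , i<i′ , same) = pigeonhole-window M (D + D) (n<1+n _) F λ i j →
          profile-window (points i) j (proj₂ (toLandmark j)) (≤-maximum (proj₁ ∘ toLandmark) j)
    in  same-profile-unresolved (profile (points i)) (profile (points i′))
          (λ j → +-cancelʳ-≡ D _ _ (same j))
          (resolving _ _ (disjoint (toℕ i) (toℕ i′) (<⇒≢ i<i′) _ _))
  where
    open Graph G
    open Landmarks G simple conn S

    c : V
    c = R 0 0

    toLandmark : ∀ j → ∃ (Walk G c (landmark j))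
    toLandmark j = conn c (landmark j)

    D N : ℕ
    D = maximum (proj₁ ∘ toLandmark)
    N = suc (suc (D + D) ^ length S)

    toRay : (i : Fin N) → ∃ (Walk G c (R (toℕ i) 0))
    toRay i = conn c (R (toℕ i) 0)

    M : ℕ
    M = maximum (proj₁ ∘ toRay)
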